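{- Let $\mathcal{S}=(E,\mathcal{I})$ be an $r$-covering system with cardinality vector $C=(c_0,\ldots,c_r)$. Let $\texttt{a}$ be an activity for $\mathcal{S}$ with activity vector $A=(a_0,\ldots,a_r)$. Then $A$ is determined by $C$ via $a_r=c_0$ and, for $1\le i\le r$, $$a_{r-i}=c_i-\sum_{j=r-i+1}^{r} a_j\binom{j}{r-i}.$$ In particular, there is at most one basis of activity number $r$.
   Context: For finite sets $X\subseteq Y$, write $[X,Y]=\{Z : X\subseteq Z\subseteq Y\}$. An $r$-covering system is a pair $\mathcal{S}=(E,\mathcal{I})$ with $E$ a finite set and $\mathcal{I}$ a collection of subsets of $E$, each of cardinality at most $r$, such that for every $I\in\mathcal{I}$ there is an $r$-element set $B\in\mathcal{I}$ with $[I,B]\subseteq\mathcal{I}$. The $r$-element sets in $\mathcal{I}$ are called bases, and $\mathcal{B}$ denotes the set of bases. An activity of $\mathcal{S}$ is a function $\texttt{a}:\mathcal{B}\to 2^E$ such that for every $B\in\mathcal{B}$, $\texttt{a}(B)\subseteq B$ and $[B\setminus\texttt{a}(B),B]\subseteq\mathcal{I}$, and such that for every $I\in\mathcal{I}$ there is a unique $B\in\mathcal{B}$ with $B\setminus\texttt{a}(B)\subseteq I\subseteq B$. The activity number of $B$ is $|\texttt{a}(B)|$. The activity vector is $(a_0,\dots,a_r)$ where $a_i$ is the number of bases of activity number $i$. The cardinality vector is $(c_0,\dots,c_r)$ where $c_i$ is the number of sets in $\mathcal{I}$ of cardinality $i$. -}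

module Defs where

open import Data.Nat using (ℕ; zero; suc; _+_; _*_; _∸_; _≟_)
open import Data.Nat.Combinatorics using (_C_)
open import Data.Bool using (Bool; true; false)
open import Data.Fin using (Fin)
open import Data.Fin.Subset using (Subset; _⊆_; _─_; ∣_∣; inside; outside)
open import Data.Vec using (_∷_; [])
open import Data.List using (List; []; _∷_; map; _++_; length; filter)
open import Data.Product using (Σ; _×_; _,_; ∃)
open import Relation.Binary.PropositionalEquality using (_≡_)
open import Relation.Nullary using (Dec; yes; no)
open import Relation.Nullary.Decidable using (_×-dec_)
open import Data.Bool.Properties using () renaming (_≟_ to _≟ᵇ_)

-- The ground set E is Fin n; a collection 𝓘 of subsets of E is given
-- by its (Boolean) indicator function on Subset n.
Collection : ℕ → Set
Collection n = Subset n → Bool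

allSubsets : (n : ℕ) → List (Subset n)
allSubsets zero = [] ∷ []
allSubsets (suc n) = map (inside ∷_) (allSubsets n) ++ map (outside ∷_) (allSubsets n)

IntervalIn : ∀ {n} → Collection n → Subset n → Subset n → Set
IntervalIn 𝓘 X Y = ∀ Z → X ⊆ Z → Z ⊆ Y → 𝓘 Z ≡ true

IsCoveringSystem : (n r : ℕ) → Collection n → Set
IsCoveringSystem n r 𝓘 =
  ∀ I → 𝓘 I ≡ true →
    (∣ I ∣ Data.Nat.≤ r) ×
    Σ (Subset n) (λ B → 𝓘 B ≡ true × ∣ B ∣ ≡ r × IntervalIn 𝓘 I B)

IsBasis : ∀ {n} → ℕ → Collection n → Subset n → Set
IsBasis r 𝓘 B = 𝓘 B ≡ true × ∣ B ∣ ≡ r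

-- activity; given as a function on all subsets, only its values on bases matter
IsActivity : (n r : ℕ) → Collection n → (Subset n → Subset n) → Set
IsActivity n r 𝓘 a =
  (∀ B → IsBasis r 𝓘 B → (a B ⊆ B) × IntervalIn 𝓘 (B ─ a B) B) ×
  (∀ I → 𝓘 I ≡ true →
     Σ (Subset n) (λ B → IsBasis r 𝓘 B × (B ─ a B) ⊆ I × I ⊆ B ×
        (∀ B' → IsBasis r 𝓘 B' → (B' ─ a B') ⊆ I → I ⊆ B' → B' ≡ B)))

_≟ˢ_ : ∀ {n} (p q : Subset n) → Dec (p ≡ q)
_≟ˢ_ = Data.Vec.Properties.≡-dec _≟ᵇ_
  where import Data.Vec.Properties

cardVec : ∀ n → Collection n → ℕ → ℕ
cardVec n 𝓘 i = length (filter (λ I → (𝓘 I ≟ᵇ true) ×-dec (∣ I ∣ ≟ i)) (allSubsets n))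

actVec : ∀ n → ℕ → Collection n → (Subset n → Subset n) → ℕ → ℕ
actVec n r 𝓘 a i =
  length (filter (λ B → ((𝓘 B ≟ᵇ true) ×-dec (∣ B ∣ ≟ r)) ×-dec (∣ a B ∣ ≟ i)) (allSubsets n))

-- Σ_{j = lo}^{hi} f j  (empty if lo > hi): sumFrom lo k f = f lo + ... + f (lo + k - 1)
sumFrom : ℕ → ℕ → (ℕ → ℕ) → ℕ
sumFrom lo zero f = 0
sumFrom lo (suc k) f = f lo + sumFrom (suc lo) k f

sumRange : ℕ → ℕ → (ℕ → ℕ) → ℕ
sumRange lo hi f = sumFrom lo (suc hi ∸ lo) f

-- The intervals [B ∖ a(B), B] of the bases partition 𝓘, and the interval of a
-- basis with activity number j contains exactly (j choose r−k) sets of size k.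
-- Double counting therefore gives c_k = Σ_j a_j (j choose r−k), a triangular
-- system: the terms with j < r−k vanish and the diagonal coefficient is 1.
-- Every set of size 0 is empty, so c_0 ≤ 1.
module Submission where

open import Defs
open import Data.Nat using (ℕ; _≤_; _∸_; _*_)
open import Data.Nat.Combinatorics using (_C_)
open import Data.Integer using (ℤ; +_; _-_)
open import Data.Fin.Subset using (Subset)
open import Data.Product using (_×_)
open import Relation.Binary.PropositionalEquality using (_≡_)

open import Data.Bool using (Bool; true; false; _∧_)
open import Data.Bool.Properties using () renaming (_≟_ to _≟ᵇ_)
open import Data.Fin.Subset using (_⊆_; _─_; ∣_∣; inside; outside)
open import Data.Fin.Subset.Properties using (_⊆?_; drop-∷-⊆; p⊆q⇒∣p∣≤∣q∣)
open import Data.List using (List; []; _∷_; _++_; filter; length; map)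
open import Data.List.Properties using (map-++; map-∘)
open import Data.Nat.ListAction using (sum)
open import Data.Nat.ListAction.Properties using (sum-++)
open import Data.Nat using (zero; suc; _+_; _<_; z≤n; s≤s; z<s; _≟_)
open import Data.Nat.Combinatorics using (nCk+nC[k+1]≡[n+1]C[k+1]; k>n⇒nCk≡0; nCn≡1)
open import Data.Nat.Properties
open import Algebra.Properties.CommutativeSemigroup +-commutativeSemigroup using (interchange)
open import Data.Product using (_,_; proj₁; proj₂)
open import Data.Vec using ([]; _∷_; here)
open import Data.Vec.Properties using (∷-injectiveʳ)
open import Function using (_∘_; mk⇔)
open import Relation.Binary.PropositionalEquality
  using (refl; sym; trans; cong; cong₂; subst; _≢_; module ≡-Reasoning)
open import Relation.Nullary using (Dec; yes; no; does; contradiction)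
open import Relation.Nullary.Decidable using (_×-dec_; dec-true; dec-false; does-⇔)
import Data.Integer.Properties as ℤ
open import Algebra.Properties.AbelianGroup ℤ.+-0-abelianGroup using (//-rightDividesʳ)

χ : Bool → ℕ
χ true = 1
χ false = 0

χ-∧ : ∀ b c → χ (b ∧ c) ≡ χ b * χ c
χ-∧ false c = refl
χ-∧ true c = sym (*-identityˡ (χ c))

χ-∧-≤ʳ : ∀ b c → χ (b ∧ c) ≤ χ c
χ-∧-≤ʳ false c = z≤n
χ-∧-≤ʳ true c = ≤-refl

χ-does-*-cong : ∀ {P : Set} (P? : Dec P) {x y} → (P → x ≡ y) → χ (does P?) * x ≡ χ (does P?) * y
χ-does-*-cong (yes p) x≡y = cong (1 *_) (x≡y p)
χ-does-*-cong (no _) _ = refl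

length-filter≡sum-χ : ∀ {A : Set} {P : A → Set} (P? : ∀ x → Dec (P x)) (xs : List A) →
  length (filter P? xs) ≡ sum (map (χ ∘ does ∘ P?) xs)
length-filter≡sum-χ P? [] = refl
length-filter≡sum-χ P? (x ∷ xs) with does (P? x)
... | true = cong suc (length-filter≡sum-χ P? xs)
... | false = length-filter≡sum-χ P? xs

∑ˢ : ∀ n → (Subset n → ℕ) → ℕ
∑ˢ zero f = f []
∑ˢ (suc n) f = ∑ˢ n (f ∘ (inside ∷_)) + ∑ˢ n (f ∘ (outside ∷_))

sum-map-allSubsets : ∀ n (f : Subset n → ℕ) → sum (map f (allSubsets n)) ≡ ∑ˢ n f
sum-map-allSubsets zero f = +-identityʳ (f [])
sum-map-allSubsets (suc n) f = begin
    sum (map f (map (inside ∷_) S ++ map (outside ∷_) S))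
  ≡⟨ cong sum (map-++ f (map (inside ∷_) S) _) ⟩
    sum (map f (map (inside ∷_) S) ++ map f (map (outside ∷_) S))
  ≡⟨ sum-++ (map f (map (inside ∷_) S)) _ ⟩
    sum (map f (map (inside ∷_) S)) + sum (map f (map (outside ∷_) S))
  ≡⟨ cong₂ _+_ (half inside) (half outside) ⟩
    ∑ˢ (suc n) f ∎
  where
  open ≡-Reasoning
  S = allSubsets n
  half : ∀ b → sum (map f (map (b ∷_) S)) ≡ ∑ˢ n (f ∘ (b ∷_))
  half b = trans (cong sum (sym (map-∘ S))) (sum-map-allSubsets n (f ∘ (b ∷_)))

length-filter-allSubsets : ∀ n {P : Subset n → Set} (P? : ∀ x → Dec (P x)) →
  length (filter P? (allSubsets n)) ≡ ∑ˢ n (χ ∘ does ∘ P?)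
length-filter-allSubsets n P? =
  trans (length-filter≡sum-χ P? (allSubsets n)) (sum-map-allSubsets n _)

∑ˢ-cong : ∀ n {f g : Subset n → ℕ} → (∀ x → f x ≡ g x) → ∑ˢ n f ≡ ∑ˢ n g
∑ˢ-cong zero f≗g = f≗g []
∑ˢ-cong (suc n) f≗g = cong₂ _+_ (∑ˢ-cong n (f≗g ∘ (inside ∷_))) (∑ˢ-cong n (f≗g ∘ (outside ∷_)))

∑ˢ-zero : ∀ n {f : Subset n → ℕ} → (∀ x → f x ≡ 0) → ∑ˢ n f ≡ 0
∑ˢ-zero zero f≗0 = f≗0 []
∑ˢ-zero (suc n) f≗0 = cong₂ _+_ (∑ˢ-zero n (f≗0 ∘ (inside ∷_))) (∑ˢ-zero n (f≗0 ∘ (outside ∷_)))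

∑ˢ-mono : ∀ n {f g : Subset n → ℕ} → (∀ x → f x ≤ g x) → ∑ˢ n f ≤ ∑ˢ n g
∑ˢ-mono zero f≤g = f≤g []
∑ˢ-mono (suc n) f≤g = +-mono-≤ (∑ˢ-mono n (f≤g ∘ (inside ∷_))) (∑ˢ-mono n (f≤g ∘ (outside ∷_)))

∑ˢ-+ : ∀ n (f g : Subset n → ℕ) → ∑ˢ n (λ x → f x + g x) ≡ ∑ˢ n f + ∑ˢ n g
∑ˢ-+ zero f g = refl
∑ˢ-+ (suc n) f g =
  trans (cong₂ _+_ (∑ˢ-+ n _ _) (∑ˢ-+ n _ _)) (interchange (∑ˢ n (f ∘ (inside ∷_))) _ _ _)

∑ˢ-*ˡ : ∀ n c (f : Subset n → ℕ) → ∑ˢ n (λ x → c * f x) ≡ c * ∑ˢ n f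
∑ˢ-*ˡ zero c f = refl
∑ˢ-*ˡ (suc n) c f = trans (cong₂ _+_ (∑ˢ-*ˡ n c _) (∑ˢ-*ˡ n c _)) (sym (*-distribˡ-+ c _ _))

∑ˢ-*ʳ : ∀ n c (f : Subset n → ℕ) → ∑ˢ n (λ x → f x * c) ≡ ∑ˢ n f * c
∑ˢ-*ʳ n c f = trans (∑ˢ-cong n (λ x → *-comm (f x) c)) (trans (∑ˢ-*ˡ n c f) (*-comm c _))

∑ˢ-swap : ∀ n m (h : Subset n → Subset m → ℕ) →
  ∑ˢ n (λ x → ∑ˢ m (h x)) ≡ ∑ˢ m (λ y → ∑ˢ n (λ x → h x y))
∑ˢ-swap zero m h = refl
∑ˢ-swap (suc n) m h = trans (cong₂ _+_ (∑ˢ-swap n m _) (∑ˢ-swap n m _)) (sym (∑ˢ-+ m _ _))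

∑ˢ-point : ∀ n (f : Subset n → ℕ) x₀ → (∀ x → x ≢ x₀ → f x ≡ 0) → ∑ˢ n f ≡ f x₀
∑ˢ-point zero f [] _ = refl
∑ˢ-point (suc n) f (true ∷ x₀) f≗0 = trans
  (cong₂ _+_ (∑ˢ-point n _ x₀ (λ x x≢x₀ → f≗0 (inside ∷ x) (x≢x₀ ∘ ∷-injectiveʳ)))
             (∑ˢ-zero n (λ x → f≗0 (outside ∷ x) λ ())))
  (+-identityʳ _)
∑ˢ-point (suc n) f (false ∷ x₀) f≗0 =
  cong₂ _+_ (∑ˢ-zero n (λ x → f≗0 (inside ∷ x) λ ()))
            (∑ˢ-point n _ x₀ (λ x x≢x₀ → f≗0 (outside ∷ x) (x≢x₀ ∘ ∷-injectiveʳ)))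

∑ˢ-χ-∣∣≡0 : ∀ n → ∑ˢ n (λ I → χ (does (∣ I ∣ ≟ 0))) ≡ 1
∑ˢ-χ-∣∣≡0 zero = refl
∑ˢ-χ-∣∣≡0 (suc n) = cong₂ _+_ (∑ˢ-zero n λ _ → refl) (∑ˢ-χ-∣∣≡0 n)

cardVec-0≤1 : ∀ n 𝓘 → cardVec n 𝓘 0 ≤ 1
cardVec-0≤1 n 𝓘 = begin
  cardVec n 𝓘 0                          ≡⟨ length-filter-allSubsets n _ ⟩
  ∑ˢ n (λ I → χ (does (𝓘 I ≟ᵇ true) ∧ does (∣ I ∣ ≟ 0)))
    ≤⟨ ∑ˢ-mono n (λ I → χ-∧-≤ʳ (does (𝓘 I ≟ᵇ true)) _) ⟩
  ∑ˢ n (λ I → χ (does (∣ I ∣ ≟ 0)))       ≡⟨ ∑ˢ-χ-∣∣≡0 n ⟩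
  1                                      ∎
  where open ≤-Reasoning

InLayer : ∀ {n} → Subset n → Subset n → ℕ → Subset n → Set
InLayer X Y t I = (X ⊆ I × I ⊆ Y) × ∣ I ∣ + t ≡ ∣ Y ∣

inLayer? : ∀ {n} (X Y : Subset n) t I → Dec (InLayer X Y t I)
inLayer? X Y t I = ((X ⊆? I) ×-dec (I ⊆? Y)) ×-dec (∣ I ∣ + t ≟ ∣ Y ∣)

∑ˢ-inLayer≡C : ∀ {n} (A Y : Subset n) → A ⊆ Y → ∀ t →
  ∑ˢ n (χ ∘ does ∘ inLayer? (Y ─ A) Y t) ≡ ∣ A ∣ C t
∑ˢ-inLayer≡C [] [] _ zero = refl
∑ˢ-inLayer≡C [] [] _ (suc t) = refl
∑ˢ-inLayer≡C {suc n} (true ∷ A) (true ∷ Y) A⊆Y zero =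
  cong₂ _+_ (∑ˢ-inLayer≡C A Y (drop-∷-⊆ A⊆Y) zero)
    (∑ˢ-zero n λ I → cong χ (dec-false (inLayer? (outside ∷ (Y ─ A)) (inside ∷ Y) zero (outside ∷ I))
      λ ((_ , I⊆Y) , eq) →
        <-irrefl eq (s≤s (subst (_≤ ∣ Y ∣) (sym (+-identityʳ ∣ I ∣)) (p⊆q⇒∣p∣≤∣q∣ (drop-∷-⊆ I⊆Y))))))
∑ˢ-inLayer≡C {suc n} (true ∷ A) (true ∷ Y) A⊆Y (suc t) = begin
    ∑ˢ n (χ ∘ does ∘ inLayer? (Y ─ A) Y (suc t))
      + ∑ˢ n (λ I → χ (does (inLayer? (outside ∷ (Y ─ A)) (inside ∷ Y) (suc t) (outside ∷ I))))
  ≡⟨ cong₂ _+_ (∑ˢ-inLayer≡C A Y A⊆Y′ (suc t))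
       (trans (∑ˢ-cong n λ I → cong (λ m → χ ((does ((Y ─ A) ⊆? I) ∧ does (I ⊆? Y)) ∧ does (m ≟ suc ∣ Y ∣)))
                                    (+-suc ∣ I ∣ t))
              (∑ˢ-inLayer≡C A Y A⊆Y′ t)) ⟩
    ∣ A ∣ C suc t + ∣ A ∣ C t
  ≡⟨ +-comm (∣ A ∣ C suc t) _ ⟩
    ∣ A ∣ C t + ∣ A ∣ C suc t
  ≡⟨ nCk+nC[k+1]≡[n+1]C[k+1] ∣ A ∣ t ⟩
    suc ∣ A ∣ C suc t ∎
  where
  open ≡-Reasoning
  A⊆Y′ = drop-∷-⊆ A⊆Y
∑ˢ-inLayer≡C (true ∷ A) (false ∷ Y) A⊆Y t = contradiction (A⊆Y here) λ ()
∑ˢ-inLayer≡C {suc n} (false ∷ A) (true ∷ Y) A⊆Y t =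
  trans (cong₂ _+_ (∑ˢ-inLayer≡C A Y (drop-∷-⊆ A⊆Y) t) (∑ˢ-zero n λ _ → refl)) (+-identityʳ _)
∑ˢ-inLayer≡C {suc n} (false ∷ A) (false ∷ Y) A⊆Y t =
  cong₂ _+_ (∑ˢ-zero n λ I → cong χ (dec-false (inLayer? (outside ∷ (Y ─ A)) (outside ∷ Y) t (inside ∷ I))
                                       λ ((_ , I⊆Y) , _) → contradiction (I⊆Y here) λ ()))
            (∑ˢ-inLayer≡C A Y (drop-∷-⊆ A⊆Y) t)

sumFrom-cong : ∀ lo k {f g : ℕ → ℕ} → (∀ j → f j ≡ g j) → sumFrom lo k f ≡ sumFrom lo k g
sumFrom-cong lo zero f≗g = refl
sumFrom-cong lo (suc k) f≗g = cong₂ _+_ (f≗g lo) (sumFrom-cong (suc lo) k f≗g)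

sumFrom-zero : ∀ lo k (f : ℕ → ℕ) → (∀ j → lo ≤ j → f j ≡ 0) → sumFrom lo k f ≡ 0
sumFrom-zero lo zero f f≗0 = refl
sumFrom-zero lo (suc k) f f≗0 =
  cong₂ _+_ (f≗0 lo ≤-refl) (sumFrom-zero (suc lo) k f (λ j lo<j → f≗0 j (<⇒≤ lo<j)))

sumFrom-skip : ∀ lo k m (f : ℕ → ℕ) → (∀ j → j < lo + k → f j ≡ 0) →
  sumFrom lo (k + m) f ≡ sumFrom (lo + k) m f
sumFrom-skip lo zero m f _ rewrite +-identityʳ lo = refl
sumFrom-skip lo (suc k) m f f≗0 = begin
  f lo + sumFrom (suc lo) (k + m) f  ≡⟨ cong₂ _+_ (f≗0 lo (m<m+n lo z<s)) (sumFrom-skip (suc lo) k m f f≗0′) ⟩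
  sumFrom (suc lo + k) m f           ≡⟨ cong (λ l → sumFrom l m f) (sym (+-suc lo k)) ⟩
  sumFrom (lo + suc k) m f           ∎
  where
  open ≡-Reasoning
  f≗0′ : ∀ j → j < suc lo + k → f j ≡ 0
  f≗0′ j j<1+lo+k = f≗0 j (subst (j <_) (sym (+-suc lo k)) j<1+lo+k)

sumFrom-point : ∀ lo k x (g : ℕ → ℕ) → lo ≤ x → x < lo + k →
  sumFrom lo k (λ j → χ (does (x ≟ j)) * g j) ≡ g x
sumFrom-point lo zero x g lo≤x x<lo+0 =
  contradiction (subst (x <_) (+-identityʳ lo) x<lo+0) (≤⇒≯ lo≤x)
sumFrom-point lo (suc k) x g lo≤x x<lo+1+k with x ≟ lo
... | yes refl = trans
  (cong₂ _+_ (trans (cong (λ b → χ b * g x) (dec-true (x ≟ x) refl)) (+-identityʳ (g x)))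
             (sumFrom-zero (suc x) k _ λ j x<j → cong (λ b → χ b * g j) (dec-false (x ≟ j) (<⇒≢ x<j))))
  (+-identityʳ (g x))
... | no x≢lo =
  trans (cong (λ b → χ b * g lo + sumFrom (suc lo) k (λ j → χ (does (x ≟ j)) * g j)) (dec-false (x ≟ lo) x≢lo))
        (sumFrom-point (suc lo) k x g (≤∧≢⇒< lo≤x (x≢lo ∘ sym)) (subst (x <_) (+-suc lo k) x<lo+1+k))

sumFrom-∑ˢ : ∀ n lo k (h : Subset n → ℕ → ℕ) →
  ∑ˢ n (λ x → sumFrom lo k (h x)) ≡ sumFrom lo k (λ j → ∑ˢ n (λ x → h x j))
sumFrom-∑ˢ n lo zero h = ∑ˢ-zero n λ _ → refl
sumFrom-∑ˢ n lo (suc k) h =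
  trans (∑ˢ-+ n _ _) (cong (λ s → ∑ˢ n (λ x → h x lo) + s) (sumFrom-∑ˢ n (suc lo) k h))

∑ˢ-by-value : ∀ n k {P : Subset n → Set} (P? : ∀ x → Dec (P x)) (φ : Subset n → ℕ) (g : ℕ → ℕ) →
  (∀ x → P x → φ x < k) →
  ∑ˢ n (λ x → χ (does (P? x)) * g (φ x)) ≡
  sumFrom 0 k (λ j → ∑ˢ n (λ x → χ (does (P? x) ∧ does (φ x ≟ j))) * g j)
∑ˢ-by-value n k P? φ g φ<k = begin
    ∑ˢ n (λ x → χ (does (P? x)) * g (φ x))
  ≡⟨ ∑ˢ-cong n by-value ⟩
    ∑ˢ n (λ x → sumFrom 0 k (λ j → χ (does (P? x) ∧ does (φ x ≟ j)) * g j))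
  ≡⟨ sumFrom-∑ˢ n 0 k _ ⟩
    sumFrom 0 k (λ j → ∑ˢ n (λ x → χ (does (P? x) ∧ does (φ x ≟ j)) * g j))
  ≡⟨ sumFrom-cong 0 k (λ j → ∑ˢ-*ʳ n (g j) _) ⟩
    sumFrom 0 k (λ j → ∑ˢ n (λ x → χ (does (P? x) ∧ does (φ x ≟ j))) * g j) ∎
  where
  open ≡-Reasoning
  by-value : ∀ x → χ (does (P? x)) * g (φ x) ≡ sumFrom 0 k (λ j → χ (does (P? x) ∧ does (φ x ≟ j)) * g j)
  by-value x with P? x
  ... | yes p = trans (+-identityʳ (g (φ x))) (sym (sumFrom-point 0 k (φ x) g z≤n (φ<k x p)))
  ... | no _ = sym (sumFrom-zero 0 k _ λ _ _ → refl)

sumFrom-*C≡diagonal+tail : ∀ {t r} (f : ℕ → ℕ) → t ≤ r →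
  sumFrom 0 (suc r) (λ j → f j * (j C t)) ≡ f t + sumFrom (suc t) (r ∸ t) (λ j → f j * (j C t))
sumFrom-*C≡diagonal+tail {t} {r} f t≤r = begin
    sumFrom 0 (suc r) F
  ≡⟨ cong (λ m → sumFrom 0 m F) (sym (trans (+-suc t (r ∸ t)) (cong suc (m+[n∸m]≡n t≤r)))) ⟩
    sumFrom 0 (t + suc (r ∸ t)) F
  ≡⟨ sumFrom-skip 0 t (suc (r ∸ t)) F (λ j j<t → trans (cong (f j *_) (k>n⇒nCk≡0 j<t)) (*-zeroʳ (f j))) ⟩
    F t + sumFrom (suc t) (r ∸ t) F
  ≡⟨ cong (_+ sumFrom (suc t) (r ∸ t) F) (trans (cong (f t *_) (nCn≡1 t)) (*-identityʳ (f t))) ⟩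
    f t + sumFrom (suc t) (r ∸ t) F ∎
  where
  open ≡-Reasoning
  F = λ j → f j * (j C t)

sumRange-from-suc : ∀ t r (f : ℕ → ℕ) → sumRange (t + 1) r f ≡ sumFrom (suc t) (r ∸ t) f
sumRange-from-suc t r f rewrite +-comm t 1 = refl

module ActivityCount (n r : ℕ) (𝓘 : Collection n) (a : Subset n → Subset n)
  (cov : IsCoveringSystem n r 𝓘) (act : IsActivity n r 𝓘 a) where

  isBasis? : ∀ B → Dec (IsBasis r 𝓘 B)
  isBasis? B = (𝓘 B ≟ᵇ true) ×-dec (∣ B ∣ ≟ r)

  basisLayer? : ∀ t I B → Dec (IsBasis r 𝓘 B × InLayer (B ─ a B) B t I)
  basisLayer? t I B = isBasis? B ×-dec inLayer? (B ─ a B) B t I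

  -- Exactly one basis interval contains a set I ∈ 𝓘 (uniqueness in the activity axiom);
  -- its corank r − |I| in that basis is r − k exactly when |I| = k, since |I| ≤ r.
  intervals-partition : ∀ k → k ≤ r → ∀ I →
    χ (does ((𝓘 I ≟ᵇ true) ×-dec (∣ I ∣ ≟ k))) ≡ ∑ˢ n (χ ∘ does ∘ basisLayer? (r ∸ k) I)
  intervals-partition k k≤r I with 𝓘 I ≟ᵇ true
  ... | no I∉𝓘 = sym (∑ˢ-zero n λ B → cong χ (dec-false (basisLayer? (r ∸ k) I B)
          λ (isB , (B∖aB⊆I , I⊆B) , _) → I∉𝓘 (proj₂ (proj₁ act B isB) I B∖aB⊆I I⊆B)))
  ... | yes I∈𝓘 with proj₂ act I I∈𝓘
  ...   | B₀ , isB₀@(_ , ∣B₀∣≡r) , B₀∖aB₀⊆I , I⊆B₀ , unique = sym (begin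
      ∑ˢ n (χ ∘ does ∘ basisLayer? (r ∸ k) I)
    ≡⟨ ∑ˢ-point n _ B₀ (λ B B≢B₀ → cong χ (dec-false (basisLayer? (r ∸ k) I B)
         λ (isB , (B∖aB⊆I , I⊆B) , _) → B≢B₀ (unique B isB B∖aB⊆I I⊆B))) ⟩
      χ (does (basisLayer? (r ∸ k) I B₀))
    ≡⟨ cong χ (does-⇔ (mk⇔ (λ (_ , _ , eq) → size-from-layer eq) size-to-layer)
                        (basisLayer? (r ∸ k) I B₀) (∣ I ∣ ≟ k)) ⟩
      χ (does (∣ I ∣ ≟ k)) ∎)
    where
    open ≡-Reasoning
    size-from-layer : ∣ I ∣ + (r ∸ k) ≡ ∣ B₀ ∣ → ∣ I ∣ ≡ k
    size-from-layer eq = +-cancelʳ-≡ (r ∸ k) ∣ I ∣ k (trans eq (trans ∣B₀∣≡r (sym (m+[n∸m]≡n k≤r))))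
    size-to-layer : ∣ I ∣ ≡ k → IsBasis r 𝓘 B₀ × InLayer (B₀ ─ a B₀) B₀ (r ∸ k) I
    size-to-layer refl = isB₀ , (B₀∖aB₀⊆I , I⊆B₀) , trans (m+[n∸m]≡n (proj₁ (cov I I∈𝓘))) (sym ∣B₀∣≡r)

  basis-layer-count : ∀ t B →
    χ (does (isBasis? B)) * ∑ˢ n (χ ∘ does ∘ inLayer? (B ─ a B) B t) ≡ χ (does (isBasis? B)) * (∣ a B ∣ C t)
  basis-layer-count t B =
    χ-does-*-cong (isBasis? B) λ isB → ∑ˢ-inLayer≡C (a B) B (proj₁ (proj₁ act B isB)) t

  activity≤r : ∀ B → IsBasis r 𝓘 B → ∣ a B ∣ < suc r
  activity≤r B isB@(_ , ∣B∣≡r) =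
    s≤s (subst (∣ a B ∣ ≤_) ∣B∣≡r (p⊆q⇒∣p∣≤∣q∣ (proj₁ (proj₁ act B isB))))

  cardVec≡∑actVec*C : ∀ k → k ≤ r →
    cardVec n 𝓘 k ≡ sumFrom 0 (suc r) (λ j → actVec n r 𝓘 a j * (j C (r ∸ k)))
  cardVec≡∑actVec*C k k≤r = begin
      cardVec n 𝓘 k
    ≡⟨ length-filter-allSubsets n _ ⟩
      ∑ˢ n (λ I → χ (does ((𝓘 I ≟ᵇ true) ×-dec (∣ I ∣ ≟ k))))
    ≡⟨ ∑ˢ-cong n (intervals-partition k k≤r) ⟩
      ∑ˢ n (λ I → ∑ˢ n (χ ∘ does ∘ basisLayer? t I))
    ≡⟨ ∑ˢ-swap n n _ ⟩
      ∑ˢ n (λ B → ∑ˢ n (λ I → χ (does (basisLayer? t I B))))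
    ≡⟨ ∑ˢ-cong n (λ B → trans (∑ˢ-cong n (λ I → χ-∧ (does (isBasis? B)) (inB B I)))
                                   (∑ˢ-*ˡ n (χ (does (isBasis? B))) (χ ∘ inB B))) ⟩
      ∑ˢ n (λ B → χ (does (isBasis? B)) * ∑ˢ n (χ ∘ inB B))
    ≡⟨ ∑ˢ-cong n (basis-layer-count t) ⟩
      ∑ˢ n (λ B → χ (does (isBasis? B)) * (∣ a B ∣ C t))
    ≡⟨ ∑ˢ-by-value n (suc r) isBasis? (∣_∣ ∘ a) (_C t) activity≤r ⟩
      sumFrom 0 (suc r) (λ j → ∑ˢ n (λ B → χ (does (isBasis? B) ∧ does (∣ a B ∣ ≟ j))) * (j C t))
    ≡⟨ sumFrom-cong 0 (suc r) (λ j → cong (_* (j C t)) (sym (length-filter-allSubsets n _))) ⟩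
      sumFrom 0 (suc r) (λ j → actVec n r 𝓘 a j * (j C t)) ∎
    where
    open ≡-Reasoning
    t = r ∸ k
    inB : Subset n → Subset n → Bool
    inB B I = does (inLayer? (B ─ a B) B t I)

  cardVec≡diagonal+tail : ∀ k → k ≤ r →
    cardVec n 𝓘 k ≡
    actVec n r 𝓘 a (r ∸ k) + sumFrom (suc (r ∸ k)) (r ∸ (r ∸ k)) (λ j → actVec n r 𝓘 a j * (j C (r ∸ k)))
  cardVec≡diagonal+tail k k≤r =
    trans (cardVec≡∑actVec*C k k≤r) (sumFrom-*C≡diagonal+tail (actVec n r 𝓘 a) (m∸n≤m r k))

theorem3p2 : (n r : ℕ) (𝓘 : Collection n) (a : Subset n → Subset n) →
  IsCoveringSystem n r 𝓘 → IsActivity n r 𝓘 a →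
  (actVec n r 𝓘 a r ≡ cardVec n 𝓘 0) ×
  (∀ i → 1 ≤ i → i ≤ r →
    + actVec n r 𝓘 a (r ∸ i) ≡
      + cardVec n 𝓘 i - + sumRange (r ∸ i Data.Nat.+ 1) r (λ j → actVec n r 𝓘 a j * (j C (r ∸ i)))) ×
  (actVec n r 𝓘 a r ≤ 1)
theorem3p2 n r 𝓘 a cov act = a-top , a-lower , subst (_≤ 1) (sym a-top) (cardVec-0≤1 n 𝓘)
  where
  open ActivityCount n r 𝓘 a cov act
  open ≡-Reasoning
  A = actVec n r 𝓘 a
  a-top : A r ≡ cardVec n 𝓘 0
  a-top = sym (begin
      cardVec n 𝓘 0
    ≡⟨ cardVec≡diagonal+tail 0 z≤n ⟩
      A r + sumFrom (suc r) (r ∸ r) F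
    ≡⟨ cong (λ m → A r + sumFrom (suc r) m F) (n∸n≡0 r) ⟩
      A r + 0
    ≡⟨ +-identityʳ (A r) ⟩
      A r ∎)
    where
    F = λ j → A j * (j C r)
  a-lower : ∀ i → 1 ≤ i → i ≤ r →
    + A (r ∸ i) ≡ + cardVec n 𝓘 i - + sumRange (r ∸ i + 1) r (λ j → A j * (j C (r ∸ i)))
  a-lower i _ i≤r = sym (begin
      + cardVec n 𝓘 i - + sumRange (r ∸ i + 1) r F
    ≡⟨ cong (λ s → + cardVec n 𝓘 i - + s) (sumRange-from-suc (r ∸ i) r F) ⟩
      + cardVec n 𝓘 i - + tail
    ≡⟨ cong (λ c → + c - + tail) (cardVec≡diagonal+tail i i≤r) ⟩
      + (A (r ∸ i) + tail) - + tail
    ≡⟨ //-rightDividesʳ (+ tail) (+ A (r ∸ i)) ⟩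
      + A (r ∸ i) ∎)
    where
    F = λ j → A j * (j C (r ∸ i))
    tail = sumFrom (suc (r ∸ i)) (r ∸ (r ∸ i)) F
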